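{- Let $\mathcal{C}$ be a collection of $\mathbf{S}$-structures over a schema $\mathbf{S}$ (closed under isomorphism). For all integers $n,m\geq0$ with $n+m>0$ and $\ell>0$: if $\mathcal{C}$ is diagrammatically $(n,m,\ell)$-compatible, then $\mathcal{C}$ is $(n,m)$-local.
   Context: A schema $\mathbf{S}$ is a finite set of relation symbols with positive arities. An $\mathbf{S}$-structure $I$ has a domain $\mathrm{dom}(I)$ contained in a fixed countably infinite set of constants and relations $R^I\subseteq\mathrm{dom}(I)^{\mathrm{ar}(R)}$; $\mathrm{facts}(I)$ is the set of facts $R(\bar c)$ with $\bar c\in R^I$, and $\mathrm{adom}(I)$ the set of elements occurring in facts. $J\subseteq I$ means $\mathrm{facts}(J)\subseteq\mathrm{facts}(I)$; $J\preceq I$ means $\mathrm{dom}(J)\subseteq\mathrm{dom}(I)$ and $R^J=R^I\cap\mathrm{dom}(J)^{\mathrm{ar}(R)}$ for all $R$. Diagrams: sentences may mention constants, interpreted as themselves. For an $\mathbf{S}$-structure $I$, a finite $K\subseteq I$ with $\mathrm{dom}(K)=\mathrm{adom}(K)$, and $m\geq0$: with distinct variables $y_1,\dots,y_m$, $C_{K,m}$ is the set of conjunctions of atoms $R(\bar u)$ with $R\in\mathbf{S}$ and $\bar u\in(\mathrm{dom}(K)\cup\{y_1,\dots,y_m\})^{\mathrm{ar}(R)}$; $N^I_{K,m}=\{\gamma(\bar y)\in C_{K,m}:I\not\models\exists\bar y\,\gamma(\bar y)\}$. For $G\subseteq N^I_{K,m}$ with $|G|\leq\ell$, the sentence $\Delta^I_{K,G}=\bigwedge_{\alpha\in\mathrm{facts}(K)}\alpha\wedge\bigwedge_{c\neq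 d\in\mathrm{dom}(K)}\neg(c=d)\wedge\bigwedge_{\gamma\in G}\neg\exists\bar y\,\gamma(\bar y)$ is an $(m,\ell)$-diagram of $K$ relative to $I$. $\mathcal{C}$ is diagrammatically $(n,m,\ell)$-compatible with $I$ if for every $K\preceq I$ with $\mathrm{dom}(K)=\mathrm{adom}(K)$, $|\mathrm{dom}(K)|\leq n$, and every $(m,\ell)$-diagram $\Delta$ of $K$ relative to $I$, some $J\in\mathcal{C}$ satisfies $\Delta$; $\mathcal{C}$ is diagrammatically $(n,m,\ell)$-compatible if every $\mathbf{S}$-structure $I$ with which $\mathcal{C}$ is diagrammatically $(n,m,\ell)$-compatible belongs to $\mathcal{C}$. Locality: for an $\mathbf{S}$-structure $J$, a finite $F\subseteq\mathrm{adom}(J)$ and $m\geq0$, the $m$-neighbourhood of $F$ in $J$ is the set of structures $J'$ with $F\subseteq\mathrm{adom}(J')$, $J'\preceq J$ and $|\mathrm{adom}(J')|\leq|F|+m$; the $m$-neighbourhood of $K\subseteq J$ in $J$ is the $m$-neighbourhood of $\mathrm{adom}(K)$ in $J$. $\mathcal{C}$ is $(n,m)$-locally embeddable in $I$ if for every $K\preceq I$ with $|\mathrm{adom}(K)|\leq n$ there is $J_K\in\mathcal{C}$ with $K\subseteq J_K$ such that for every $J'$ in the $m$-neighbourhood of $K$ in $J_K$ there is a function $h:\mathrm{adom}(J')\to\mathrm{adom}(I)$ that is the identity on $\mathrm{adom}(K)$ with $h(\mathrm{facts}(J'))\subseteq\mathrm{facts}(I)$. $\mathcal{C}$ is $(n,m)$-local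 if every $\mathbf{S}$-structure $I$ in which $\mathcal{C}$ is $(n,m)$-locally embeddable belongs to $\mathcal{C}$. -}

module Defs where

open import Data.Nat using (ℕ; _+_; _≤_; _<_)
open import Data.Fin using (Fin)
open import Data.Unit using (⊤)
open import Data.Vec using (Vec; map)
open import Data.Vec.Membership.Propositional using () renaming (_∈_ to _∈ᵥ_)
open import Data.Vec.Relation.Unary.All using () renaming (All to VAll)
open import Data.List using (List; length)
open import Data.List.NonEmpty using (List⁺; toList)
open import Data.List.Membership.Propositional using (_∈_)
open import Data.List.Relation.Unary.All using (All)
open import Data.List.Relation.Unary.Unique.Propositional using (Unique)
open import Data.Product using (Σ; _×_; _,_)
open import Relation.Nullary using (¬_)
open import Relation.Binary.PropositionalEquality using (_≡_; _≢_)

record Schema : Set where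
  field
    nsym   : ℕ
    ar     : Fin nsym → ℕ
    ar-pos : ∀ R → 0 < ar R

-- The fixed countably infinite set of constants is ℕ.
Const : Set
Const = ℕ

module _ (S : Schema) where
  open Schema S

  Sym : Set
  Sym = Fin nsym

  record Structure : Set₁ where
    field
      dom     : Const → Set
      rel     : (R : Sym) → Vec Const (ar R) → Set
      rel⊆dom : ∀ R t → rel R t → VAll dom t
  open Structure public

  _⊆ᶠ_ : Structure → Structure → Set
  J ⊆ᶠ I = ∀ R t → rel J R t → rel I R t

  _≼_ : Structure → Structure → Set
  J ≼ I = (∀ x → dom J x → dom I x)
        × (∀ R t → (rel J R t → rel I R t × VAll (dom J) t)
                 × (rel I R t × VAll (dom J) t → rel J R t))

  adom : Structure → Const → Set
  adom J x = Σ Sym λ R → Σ (Vec Const (ar R)) λ t → rel J R t × x ∈ᵥ t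

  HasSize : (Const → Set) → ℕ → Set
  HasSize P k = Σ (List Const) λ xs →
    Unique xs × (∀ x → (P x → x ∈ xs) × (x ∈ xs → P x)) × length xs ≡ k

  SizeAtMost : (Const → Set) → ℕ → Set
  SizeAtMost P n = Σ ℕ λ k → HasSize P k × k ≤ n

  record Iso (I J : Structure) : Set where
    field
      f       : Const → Const
      g       : Const → Const
      f-dom   : ∀ x → dom I x → dom J (f x)
      g-dom   : ∀ y → dom J y → dom I (g y)
      gf      : ∀ x → dom I x → g (f x) ≡ x
      fg      : ∀ y → dom J y → f (g y) ≡ y
      rel-to  : ∀ R t → VAll (dom I) t → rel I R t → rel J R (map f t)
      rel-fro : ∀ R t → VAll (dom I) t → rel J R (map f t) → rel I R t

  IsoClosed : (Structure → Set) → Set₁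
  IsoClosed 𝒞 = ∀ I J → Iso I J → 𝒞 I → 𝒞 J

  data Term (m : ℕ) : Set where
    con : Const → Term m
    var : Fin m → Term m

  Atom : ℕ → Set
  Atom m = Σ Sym λ R → Vec (Term m) (ar R)

  Conj : ℕ → Set
  Conj m = List⁺ (Atom m)

  eval : ∀ {m} → (Fin m → Const) → Term m → Const
  eval a (con c) = c
  eval a (var i) = a i

  TermOver : ∀ {m} → Structure → Term m → Set
  TermOver K (con c) = dom K c
  TermOver K (var i) = ⊤

  InC : ∀ {m} → Structure → Conj m → Set
  InC K γ = All (λ { (R , u) → VAll (TermOver K) u }) (toList γ)

  SatEx : ∀ {m} → Structure → Conj m → Set
  SatEx {m} J γ = Σ (Fin m → Const) λ a →
    (∀ i → dom J (a i)) × All (λ { (R , u) → rel J R (map (eval a) u) }) (toList γ)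

  InN : ∀ {m} → Structure → Structure → Conj m → Set
  InN I K γ = InC K γ × ¬ SatEx I γ

  SatDiagram : ∀ {m} → Structure → Structure → List (Conj m) → Set
  SatDiagram J K G =
      (K ⊆ᶠ J)
    × (∀ c d → dom K c → dom K d → c ≢ d → ¬ (c ≡ d))
    × All (λ γ → ¬ SatEx J γ) G

  DomIsAdom : Structure → Set
  DomIsAdom K = ∀ x → dom K x → adom K x

  DiagCompatWith : (Structure → Set) → ℕ → ℕ → ℕ → Structure → Set₁
  DiagCompatWith 𝒞 n m ℓ I =
    ∀ (K : Structure) → K ≼ I → DomIsAdom K → SizeAtMost (dom K) n →
    ∀ (G : List (Conj m)) → length G ≤ ℓ → All (InN I K) G →
    Σ Structure λ J → 𝒞 J × SatDiagram J K G

  DiagCompatible : (Structure → Set) → ℕ → ℕ → ℕ → Set₁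
  DiagCompatible 𝒞 n m ℓ = ∀ I → DiagCompatWith 𝒞 n m ℓ I → 𝒞 I

  InNbhd : Structure → Structure → ℕ → Structure → Set
  InNbhd J K m J' =
      (∀ x → adom K x → adom J' x)
    × J' ≼ J
    × Σ ℕ λ k → Σ ℕ λ k' → HasSize (adom K) k × HasSize (adom J') k' × k' ≤ k + m

  LocallyEmbeddable : (Structure → Set) → ℕ → ℕ → Structure → Set₁
  LocallyEmbeddable 𝒞 n m I =
    ∀ (K : Structure) → K ≼ I → SizeAtMost (adom K) n →
    Σ Structure λ JK → 𝒞 JK × K ⊆ᶠ JK ×
      (∀ (J' : Structure) → InNbhd JK K m J' →
        Σ (Const → Const) λ h →
            (∀ x → adom J' x → adom I (h x))
          × (∀ x → adom K x → h x ≡ x)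
          × (∀ R t → rel J' R t → rel I R (map h t)))

  Local : (Structure → Set) → ℕ → ℕ → Set₁
  Local 𝒞 n m = ∀ I → LocallyEmbeddable 𝒞 n m I → 𝒞 I

-- Let 𝒞 be (n,m)-locally embeddable in I, and let K ≼ I carry a diagram whose
-- negative part is G ⊆ N^I_{K,m}. The structure J_K ∈ 𝒞 provided for K contains
-- the facts of K, and it satisfies no γ ∈ G: a witness ā of ∃ȳ γ in J_K spans,
-- together with dom(K), a substructure of J_K with at most |K| + m elements, i.e.
-- a member of the m-neighbourhood of K. Its map into I fixes K and hence the
-- constants of γ, so it carries ā to a witness of ∃ȳ γ in I, contradicting
-- γ ∈ N^I_{K,m}. So J_K satisfies the diagram, and diagrammatic compatibility
-- puts I in 𝒞.
module Submission where

open import Defs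
open import Data.Nat using (ℕ; _+_; _<_; _≤_; z≤n; s≤s; _≟_)
open import Data.Nat.Properties using (≤-trans; +-monoʳ-≤; module ≤-Reasoning)
open import Data.Fin using (Fin)
open import Data.Product using (Σ; ∃; _×_; _,_; proj₁; proj₂)
open import Data.Sum using (inj₁; inj₂)
open import Function using (_∘_; id)
open import Relation.Nullary using (Dec; yes; no)
open import Data.Empty using (⊥-elim)
open import Relation.Unary using (Pred)
open import Relation.Binary.Core using (Rel)
open import Relation.Binary.Definitions using (Decidable)
open import Relation.Binary.PropositionalEquality
  using (_≡_; refl; sym; trans; cong₂; subst; module ≡-Reasoning)
open import Data.Vec as Vec using (Vec; []; _∷_)
open import Data.Vec.Properties using (map-∘)
open import Data.Vec.Relation.Unary.Any using (here; there)
open import Data.Vec.Relation.Unary.All as VAll using ([]; _∷_) renaming (All to VAll)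
open import Data.Vec.Relation.Unary.All.Properties using (map⁺)
open import Data.Vec.Membership.Propositional using () renaming (_∈_ to _∈ᵥ_)
open import Data.Vec.Membership.Propositional.Properties using (∈-map⁺)
import Data.Vec.Membership.DecPropositional _≟_ as VecMembership
open import Data.List as List using (List; _++_; length; filter; deduplicate)
open import Data.List.NonEmpty using (toList; head)
open import Data.List.Properties using (length-++; length-filter; length-tabulate)
open import Data.List.Relation.Unary.All as All using (All)
open import Data.List.Relation.Unary.Any as Any using (Any)
open import Data.List.Membership.Propositional using (_∈_; find; lose)
open import Data.List.Membership.Propositional.Properties
  using (∈-++⁺ˡ; ∈-++⁺ʳ; ∈-++⁻; ∈-filter⁺; ∈-filter⁻; ∈-tabulate⁺;
         ∈-deduplicate⁺; ∈-deduplicate⁻)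
open import Data.List.Membership.DecPropositional _≟_ using (_∈?_)
open import Data.List.Relation.Unary.Unique.DecPropositional.Properties _≟_
  using (deduplicate-!)

length-deduplicate : ∀ {a r} {A : Set a} {R : Rel A r} (R? : Decidable R) xs →
                     length (deduplicate R? xs) ≤ length xs
length-deduplicate R? List.[]       = z≤n
length-deduplicate R? (x List.∷ xs) =
  s≤s (≤-trans (length-filter _ (deduplicate R? xs)) (length-deduplicate R? xs))

module _ {a p} {A : Set a} {P : Pred A p} where

  VAll-tabulate∈ : ∀ {k} {xs : Vec A k} → (∀ {x} → x ∈ᵥ xs → P x) → VAll P xs
  VAll-tabulate∈ {xs = []}     f = []
  VAll-tabulate∈ {xs = x ∷ xs} f = f (here refl) ∷ VAll-tabulate∈ (f ∘ there)

  VAll-nonempty⇒∃ : ∀ {k} {xs : Vec A k} → 0 < k → VAll P xs → ∃ P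
  VAll-nonempty⇒∃ {xs = x ∷ _} _ (px ∷ _) = x , px

map-cong-VAll : ∀ {a b} {A : Set a} {B : Set b} {f g : A → B} {k} {xs : Vec A k} →
                VAll (λ x → f x ≡ g x) xs → Vec.map f xs ≡ Vec.map g xs
map-cong-VAll []           = refl
map-cong-VAll (fx≡gx ∷ eqs) = cong₂ _∷_ fx≡gx (map-cong-VAll eqs)

module _ (S : Schema) where
  open Schema S

  adom⇒dom : (J : Structure S) {x : Const} → adom S J x → dom J x
  adom⇒dom J (R , t , r , x∈t) = VAll.lookup (rel⊆dom J R t r) x∈t

  HasSize-cong : ∀ {P Q : Const → Set} {k} →
                 (∀ x → P x → Q x) → (∀ x → Q x → P x) → HasSize S P k → HasSize S Q k
  HasSize-cong P⊆Q Q⊆P (xs , unique , enum , len) =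
    xs , unique , (λ x → proj₁ (enum x) ∘ Q⊆P x , P⊆Q x ∘ proj₂ (enum x)) , len

  restrict : Structure S → List Const → Structure S
  restrict J L = record
    { dom     = _∈ L
    ; rel     = λ R t → rel J R t × VAll (_∈ L) t
    ; rel⊆dom = λ _ _ → proj₂
    }

  restrict-≼ : (J : Structure S) {L : List Const} → (∀ {x} → x ∈ L → dom J x) →
               _≼_ S (restrict J L) J
  restrict-≼ J L⊆J = (λ _ → L⊆J) , λ _ _ → id , id

  adom-restrict⇒adom : (J : Structure S) {L : List Const} {x : Const} →
                       adom S (restrict J L) x → adom S J x
  adom-restrict⇒adom J (R , t , (r , _) , x∈t) = R , t , r , x∈t

  adom-restrict⇒∈ : (J : Structure S) {L : List Const} {x : Const} →
                    adom S (restrict J L) x → x ∈ L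
  adom-restrict⇒∈ J (R , t , (_ , t⊆L) , x∈t) = VAll.lookup t⊆L x∈t

  Witnessed : ∀ {m} → Structure S → Conj S m → (Fin m → Const) → Set
  Witnessed J γ a = All (λ at → rel J (proj₁ at) (Vec.map (eval S a) (proj₂ at))) (toList γ)

  module _ {m} (K : Structure S) (h : Const → Const) (h-fix : ∀ c → dom K c → h c ≡ c)
           (a : Fin m → Const) where

    eval-∘ : ∀ t → TermOver S K t → eval S (h ∘ a) t ≡ h (eval S a t)
    eval-∘ (con c) c∈K = sym (h-fix c c∈K)
    eval-∘ (var i) _   = refl

    map-eval-∘ : ∀ {k} {u : Vec (Term S m) k} → VAll (TermOver S K) u →
                 Vec.map (eval S (h ∘ a)) u ≡ Vec.map h (Vec.map (eval S a) u)
    map-eval-∘ {u = u} u⊆K = begin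
      Vec.map (eval S (h ∘ a)) u       ≡⟨ map-cong-VAll (VAll.map (λ {t} → eval-∘ t) u⊆K) ⟩
      Vec.map (h ∘ eval S a) u         ≡⟨ map-∘ h (eval S a) u ⟩
      Vec.map h (Vec.map (eval S a) u) ∎
      where open ≡-Reasoning

    Witnessed-hom : {J I : Structure S} {γ : Conj S m} →
                    (∀ R t → rel J R t → rel I R (Vec.map h t)) →
                    InC S K γ → Witnessed J γ a → Witnessed I γ (h ∘ a)
    Witnessed-hom {I = I} h-hom γ⊆K J⊨γ[a] = All.zipWith
      (λ { {R , u} (u⊆K , r) → subst (rel I R) (sym (map-eval-∘ u⊆K)) (h-hom R _ r) })
      (γ⊆K , J⊨γ[a])

  HomOver : Structure S → Structure S → Structure S → Set
  HomOver K J' I =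
    Σ (Const → Const) λ h →
        (∀ x → adom S J' x → adom S I (h x))
      × (∀ x → adom S K x → h x ≡ x)
      × (∀ R t → rel J' R t → rel I R (Vec.map h t))

  NbhdEmbeds : Structure S → Structure S → Structure S → ℕ → Set₁
  NbhdEmbeds I J K m = ∀ (J' : Structure S) → InNbhd S J K m J' → HomOver K J' I

  module _ (L : List Const) (h : Const → Const) (d : Const) where

    extend : Const → Const
    extend x with x ∈? L
    ... | yes _ = h x
    ... | no  _ = d

    extend-agrees : ∀ {x} → x ∈ L → extend x ≡ h x
    extend-agrees {x} x∈L with x ∈? L
    ... | yes _  = refl
    ... | no x∉L = ⊥-elim (x∉L x∈L)

    extend-into : (P : Const → Set) → (∀ {x} → x ∈ L → P (h x)) → P d → ∀ x → P (extend x)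
    extend-into P hL⊆P Pd x with x ∈? L
    ... | yes x∈L = hL⊆P x∈L
    ... | no  _   = Pd

  -- The member of the m-neighbourhood of K in J spanned by dom(K) and the values
  -- of a witness ā of ∃ȳ γ that occur in γ.
  module WitnessNeighbourhood
    {m k} (K J : Structure S) (K-dom : DomIsAdom S K) (K-size : HasSize S (adom S K) k)
    (K⊆J : _⊆ᶠ_ S K J) (γ : Conj S m) (γ∈C : InC S K γ)
    (a : Fin m → Const) (J⊨γ[a] : Witnessed J γ a) where

    Occurs : Const → Set
    Occurs y = Any (λ at → y ∈ᵥ Vec.map (eval S a) (proj₂ at)) (toList γ)

    occurs? : (y : Const) → Dec (Occurs y)
    occurs? y = Any.any? (λ at → y VecMembership.∈? Vec.map (eval S a) (proj₂ at)) (toList γ)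

    xs : List Const
    xs = proj₁ K-size

    xs-enum : ∀ x → (adom S K x → x ∈ xs) × (x ∈ xs → adom S K x)
    xs-enum = proj₁ (proj₂ (proj₂ K-size))

    occurring : List Const
    occurring = filter occurs? (List.tabulate a)

    support : List Const
    support = deduplicate _≟_ (xs ++ occurring)

    J' : Structure S
    J' = restrict J support

    K⊆support : ∀ {x} → dom K x → x ∈ support
    K⊆support {x} x∈K =
      ∈-deduplicate⁺ _≟_ (∈-++⁺ˡ (proj₁ (xs-enum x) (K-dom x x∈K)))

    occurring⊆support : ∀ i → Occurs (a i) → a i ∈ support
    occurring⊆support i occ =
      ∈-deduplicate⁺ _≟_ (∈-++⁺ʳ xs (∈-filter⁺ occurs? (∈-tabulate⁺ i) occ))

    term∈support : ∀ t → TermOver S K t → Occurs (eval S a t) → eval S a t ∈ support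
    term∈support (con c) c∈K _   = K⊆support c∈K
    term∈support (var i) _   occ = occurring⊆support i occ

    J'⊨γ[a] : Witnessed J' γ a
    J'⊨γ[a] = All.tabulate λ {(R , u)} at∈γ →
      let u⊆K = All.lookup γ∈C at∈γ
      in All.lookup J⊨γ[a] at∈γ ,
         map⁺ (VAll-tabulate∈ λ {t} t∈u →
           term∈support t (VAll.lookup u⊆K t∈u)
             (lose at∈γ (∈-map⁺ (eval S a) t∈u)))

    support⊆adom : ∀ {x} → x ∈ support → adom S J' x
    support⊆adom {x} x∈support with ∈-++⁻ xs (∈-deduplicate⁻ _≟_ _ x∈support)
    ... | inj₁ x∈xs =
      let (R , t , r , x∈t) = proj₂ (xs-enum x) x∈xs
      in R , t , (K⊆J R t r , VAll.map K⊆support (rel⊆dom K R t r)) , x∈t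
    ... | inj₂ x∈occ =
      let (at , at∈γ , x∈at) = find (proj₂ (∈-filter⁻ occurs? {xs = List.tabulate a} x∈occ))
      in proj₁ at , _ , All.lookup J'⊨γ[a] at∈γ , x∈at

    support-length : length support ≤ k + m
    support-length = begin
      length support                ≤⟨ length-deduplicate _≟_ (xs ++ occurring) ⟩
      length (xs ++ occurring)      ≡⟨ length-++ xs ⟩
      length xs + length occurring
        ≤⟨ +-monoʳ-≤ (length xs) (length-filter occurs? (List.tabulate a)) ⟩
      length xs + length (List.tabulate a)
        ≡⟨ cong₂ _+_ refl (length-tabulate a) ⟩
      length xs + m                 ≡⟨ cong₂ _+_ (proj₂ (proj₂ (proj₂ K-size))) refl ⟩
      k + m                         ∎
      where open ≤-Reasoning

    J'∈nbhd : InNbhd S J K m J'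
    J'∈nbhd =
        (λ x → support⊆adom ∘ K⊆support ∘ adom⇒dom K)
      , restrict-≼ J (adom⇒dom J ∘ adom-restrict⇒adom J ∘ support⊆adom)
      , k , length support
      , K-size
      , (support , deduplicate-! _ , (λ x → adom-restrict⇒∈ J , support⊆adom) , refl)
      , support-length

    HomOver-SatEx : (I : Structure S) → HomOver K J' I → SatEx S I γ
    HomOver-SatEx I (h , h-adom , h-fixes , h-hom) =
      h' ∘ a , (λ i → h'-into-I (a i)) ,
      Witnessed-hom K h' h'-fixes a {J'} {I} h'-hom γ∈C J'⊨γ[a]
      where
      -- h is controlled only on the support, but every variable needs a value in I:
      -- send the rest to a point of I, which exists as the first atom of γ has
      -- positive arity.
      d : ∃ (dom I)
      d = let (R , _) = head γ in
        VAll-nonempty⇒∃ (ar-pos R) (rel⊆dom I R _ (h-hom R _ (All.lookup J'⊨γ[a] (Any.here refl))))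

      h' : Const → Const
      h' = extend support h (proj₁ d)

      h'-into-I : ∀ x → dom I (h' x)
      h'-into-I = extend-into support h (proj₁ d) (dom I)
        (adom⇒dom I ∘ h-adom _ ∘ support⊆adom) (proj₂ d)

      h'-fixes : ∀ c → dom K c → h' c ≡ c
      h'-fixes c c∈K = trans (extend-agrees support h _ (K⊆support c∈K)) (h-fixes c (K-dom c c∈K))

      h'-hom : ∀ R t → rel J' R t → rel I R (Vec.map h' t)
      h'-hom R t (r , t⊆support) = subst (rel I R)
        (sym (map-cong-VAll (VAll.map (extend-agrees support h _) t⊆support)))
        (h-hom R t (r , t⊆support))

  SatEx-transfer : ∀ {m k} (I J K : Structure S) → DomIsAdom S K → HasSize S (adom S K) k →
                   _⊆ᶠ_ S K J → NbhdEmbeds I J K m →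
                   (γ : Conj S m) → InC S K γ → SatEx S J γ → SatEx S I γ
  SatEx-transfer I J K K-dom K-size K⊆J embeds γ γ∈C (a , _ , J⊨γ[a]) =
    HomOver-SatEx I (embeds J' J'∈nbhd)
    where open WitnessNeighbourhood K J K-dom K-size K⊆J γ γ∈C a J⊨γ[a]

proposition1 : (S : Schema) (𝒞 : Structure S → Set) → IsoClosed S 𝒞 →
    (n m ℓ : ℕ) → 0 < n + m → 0 < ℓ →
    DiagCompatible S 𝒞 n m ℓ → Local S 𝒞 n m
proposition1 S 𝒞 _ n m ℓ _ _ compatible I embeddable = compatible I compatible-with-I
  where
  compatible-with-I : DiagCompatWith S 𝒞 n m ℓ I
  compatible-with-I K K≼I K-dom (k , K-size , k≤n) G _ G⊆N =
    let K-adom-size = HasSize-cong S K-dom (λ _ → adom⇒dom S K) K-size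
        (JK , JK∈𝒞 , K⊆JK , embeds) = embeddable K K≼I (k , K-adom-size , k≤n)
    in JK , JK∈𝒞 , K⊆JK , (λ _ _ _ _ c≢d → c≢d) ,
       All.map (λ { {γ} (γ∈C , I⊭γ) →
                    I⊭γ ∘ SatEx-transfer S I JK K K-dom K-adom-size K⊆JK embeds γ γ∈C })
               G⊆N
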